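{- Suppose that $\mathfrak s$ satisfies transitivity. Suppose that $A^*, A, B, C \in \mathcal K_\lambda$ and $b \in B \setminus A$ are such that $A^* \leq_{\mathcal K} A <_{\mathcal K} B$, $A <_{\mathcal K} C$, and $\mathrm{tp}(b/A;B)$ does not fork over $A^*$ (i.e., $(A^*, A, b, B)$ is in the non-forking relation of $\mathfrak s$). If $C$ witnesses the non-uniqueness of $(A, B, b)$, then it also witnesses the non-uniqueness of $(A^*, B, b)$.
   Context: $\mathfrak s=(\mathcal K,\downarrow,S^{\mathrm{bs}})$ is a pre-$\lambda$-frame: $\mathcal K$ an AEC with $\mathrm{LS}(\mathcal K)\leq\lambda$; basic types $S^{\mathrm{bs}}(A)\subseteq S^{\mathrm{na}}(A)$ for $A\in\mathcal K_\lambda$; $\downarrow$ the non-forking relation on quadruples $(A,B,c,C)$ with $A\leq_{\mathcal K}B<_{\mathcal K}C$ in $\mathcal K_\lambda$, $c\in C\setminus B$, isomorphism invariant and monotone, with $\downarrow(A,A,c,C)$ implying $\mathrm{tp}(c/A;C)$ basic; "$\mathrm{tp}(c/B;C)$ does not fork over $A$" means $\downarrow(A,B,c,C)$. $\mathcal K_\lambda$ has the amalgamation property. Transitivity: for $A\leq_{\mathcal K}B\leq_{\mathcal K}C$ and $p\in S(C)$, if $p$ does not fork over $B$ and $p\restriction B$ does not fork over $A$ then $p$ does not fork over $A$. For a basic triple $(A,B,b)$ ($A<_{\mathcal K}B$ in $\mathcal K_\lambda$, $b\in B\setminus A$, basic type over $A$), $C\in\mathcal K_\lambda$ with $A<_{\mathcal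 K}C$ witnesses its non-uniqueness if there are two non-equivalent $\lambda$-amalgamations $(f^D_B,\mathrm{id}_C,D)$, $(f^F_B,\mathrm{id}_C,F)$ of $B$ and $C$ over $A$ (equivalence: compatible embeddings into a common model) with $\mathrm{tp}(f^D_B(b)/C;D)=\mathrm{tp}(f^F_B(b)/C;F)$ not forking over $A$. -}

module Defs where

open import Data.Product using (Σ; _×_; _,_; proj₁; proj₂)
open import Relation.Binary.PropositionalEquality using (_≡_)
open import Relation.Binary.Construct.Closure.Transitive using (TransClosure)
open import Relation.Nullary using (¬_)

-- The category K_λ of an AEC K with LS(K) ≤ λ, presented abstractly:
-- models (all of size λ), their universes, K-embeddings, and the strong
-- substructure relation ≤_K (a proposition), whose witnesses induce the
-- inclusion maps ι.
record AECλ : Set₁ where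
  infixr 9 _∘H_
  infix 4 _≤_
  field
    Model : Set
    El    : Model → Set
    Hom   : Model → Model → Set
    ap    : {M N : Model} → Hom M N → El M → El N
    ap-inj : {M N : Model} (f : Hom M N) {x y : El M} → ap f x ≡ ap f y → x ≡ y
    idH   : {M : Model} → Hom M M
    ap-id : {M : Model} (x : El M) → ap (idH {M}) x ≡ x
    _∘H_  : {M N P : Model} → Hom N P → Hom M N → Hom M P
    ap-∘  : {M N P : Model} (g : Hom N P) (f : Hom M N) (x : El M) →
            ap (g ∘H f) x ≡ ap g (ap f x)
    _≤_   : Model → Model → Set
    ≤-prop  : {M N : Model} (p q : M ≤ N) → p ≡ q
    ≤-refl  : {M : Model} → M ≤ M
    ≤-trans : {M N P : Model} → M ≤ N → N ≤ P → M ≤ P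
    ι       : {M N : Model} → M ≤ N → Hom M N
    ι-refl  : {M : Model} (x : El M) → ap (ι (≤-refl {M})) x ≡ x
    ι-trans : {M N P : Model} (p : M ≤ N) (q : N ≤ P) (x : El M) →
              ap (ι (≤-trans p q)) x ≡ ap (ι q) (ap (ι p) x)
    amalgamation : {A B C : Model} (p : A ≤ B) (r : A ≤ C) →
      Σ Model λ D → Σ (Hom B D) λ f → Σ (C ≤ D) λ q →
        ((a : El A) → ap f (ap (ι p) a) ≡ ap (ι q) (ap (ι r) a))

module _ (K : AECλ) where
  open AECλ K

  NotIn : {A C : Model} → A ≤ C → El C → Set
  NotIn {A} p c = ¬ (Σ (El A) λ a → ap (ι p) a ≡ c)

  _<K_ : Model → Model → Set
  A <K C = Σ (A ≤ C) λ p → Σ (El C) λ c → NotIn p c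

  -- triples (A, M, c) with A ≤ M, c ∈ M: representatives of Galois types over A
  Rep : Model → Set
  Rep A = Σ Model λ M → (A ≤ M) × El M

  AtEq : (A : Model) → Rep A → Rep A → Set
  AtEq A (M₁ , p₁ , c₁) (M₂ , p₂ , c₂) =
    Σ Model λ N → Σ (Hom M₁ N) λ g₁ → Σ (Hom M₂ N) λ g₂ →
      ((a : El A) → ap g₁ (ap (ι p₁) a) ≡ ap g₂ (ap (ι p₂) a)) ×
      (ap g₁ c₁ ≡ ap g₂ c₂)

  -- equality of Galois types: tp(c₁/A;M₁) = tp(c₂/A;M₂)
  TpEq : (A : Model) → Rep A → Rep A → Set
  TpEq A = TransClosure (AtEq A)

-- A pre-λ-frame s = (K, ↓, S^bs).
-- nf p q c  means ↓(A,B,c,C) for p : A ≤ B, q : B ≤ C, c ∈ C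
-- (only meaningful when c ∉ B and B < C).
record PreFrame : Set₁ where
  field
    K : AECλ
  open AECλ K public
  field
    Sbs : {A M : Model} → A ≤ M → El M → Set      -- tp(c/A;M) ∈ S^bs(A)
    Sbs-tp : {A M N : Model} (p : A ≤ M) (c : El M) (q : A ≤ N) (d : El N) →
             TpEq K A (M , p , c) (N , q , d) → Sbs p c → Sbs q d
    nf  : {A B C : Model} → A ≤ B → B ≤ C → El C → Set
    nf-bs : {A C : Model} (q : A ≤ C) (c : El C) → NotIn K q c →
            nf ≤-refl q c → Sbs q c
    -- isomorphism invariance (+ monotonicity in C): non-forking is preserved
    -- and reflected by K-embeddings of C over B
    nf-inv : {A B C C' : Model} (p : A ≤ B) (q : B ≤ C) (q' : B ≤ C')
             (f : Hom C C') (c : El C) →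
             ((x : El B) → ap f (ap (ι q) x) ≡ ap (ι q') x) →
             NotIn K q c → (nf p q c → nf p q' (ap f c)) × (nf p q' (ap f c) → nf p q c)
    nf-mono : {A A' B' B C : Model} (i : A ≤ A') (j : A' ≤ B') (k : B' ≤ B)
              (q : B ≤ C) (c : El C) → NotIn K q c →
              nf (≤-trans i (≤-trans j k)) q c → nf j (≤-trans k q) c

module _ (s : PreFrame) where
  open PreFrame s

  -- transitivity (stated on representatives of p = tp(d/C;D))
  Transitivity : Set
  Transitivity = {A B C D : Model} (i : A ≤ B) (j : B ≤ C) (q : C ≤ D) (d : El D) →
    NotIn K q d → nf j q d → nf i (≤-trans j q) d → nf (≤-trans i j) q d

  BasicTriple : {A B : Model} → A ≤ B → El B → Set
  BasicTriple p b = NotIn K p b × Sbs p b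

  record Amalg {A B C : Model} (p : A ≤ B) (r : A ≤ C) : Set where
    field
      D   : Model
      fB  : Hom B D
      idC : C ≤ D
      over : (a : El A) → ap fB (ap (ι p) a) ≡ ap (ι idC) (ap (ι r) a)

  AmalgEquiv : {A B C : Model} {p : A ≤ B} {r : A ≤ C} → Amalg p r → Amalg p r → Set
  AmalgEquiv {B = B} {C = C} a₁ a₂ =
    Σ Model λ E → Σ (Hom (Amalg.D a₁) E) λ g₁ → Σ (Hom (Amalg.D a₂) E) λ g₂ →
      ((x : El B) → ap g₁ (ap (Amalg.fB a₁) x) ≡ ap g₂ (ap (Amalg.fB a₂) x)) ×
      ((y : El C) → ap g₁ (ap (ι (Amalg.idC a₁)) y) ≡ ap g₂ (ap (ι (Amalg.idC a₂)) y))

  Witness : {A B C : Model} → A ≤ B → El B → A ≤ C → Set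
  Witness {A} {B} {C} p b r =
    BasicTriple p b ×
    (Σ (El C) λ c → NotIn K r c) ×
    Σ (Amalg p r) λ a₁ → Σ (Amalg p r) λ a₂ →
      ¬ AmalgEquiv a₁ a₂ ×
      TpEq K C (Amalg.D a₁ , Amalg.idC a₁ , ap (Amalg.fB a₁) b)
               (Amalg.D a₂ , Amalg.idC a₂ , ap (Amalg.fB a₂) b) ×
      NotIn K (Amalg.idC a₁) (ap (Amalg.fB a₁) b) ×
      nf r (Amalg.idC a₁) (ap (Amalg.fB a₁) b)

module Submission where

-- Let C witness the non-uniqueness of (A, B, b) by amalgamations a₁, a₂ of
-- B and C over A, and suppose tp(b/A;B) does not fork over A*.  Every
-- amalgamation over A is also one over A* (with the same data), so a₁, a₂
-- remain non-equivalent amalgamations with equal types of the image of b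
-- over C.  What has to be checked is:
--   * elements outside A are outside A*, so (A*, B, b) is a triple and
--     C is a proper extension of A*;
--   * tp(b/A*;B) is basic: by monotonicity ↓(A*, A*, b, B), then nf-bs;
--   * the image of b in D₁ does not fork over A*: transporting ↓(A*, A, b, B)
--     along f_B gives ↓(A*, A, f_B b, D₁) computed over A ≤ C ≤ D₁, and
--     transitivity combines it with ↓(A, C, f_B b, D₁).

open import Defs
open import Data.Product using (Σ; _×_; _,_; proj₁)
open import Relation.Binary.PropositionalEquality using (_≡_; sym; trans; cong; subst; module ≡-Reasoning)

module _ (s : PreFrame) where
  open PreFrame s

  notIn-below : {A* A X : Model} (i : A* ≤ A) (q : A ≤ X) (x : El X) →
    NotIn K q x → NotIn K (≤-trans i q) x
  notIn-below i q x x∉A (a , ιa≡x) = x∉A (ap (ι i) a , trans (sym (ι-trans i q a)) ιa≡x)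

  -- If tp(b/A;B) does not fork over A* and b ∉ A, then tp(b/A*;B) is basic:
  -- monotonicity shrinks ↓(A*, A, b, B) to ↓(A*, A*, b, B), which implies basic.
  basic-over-base : {A* A B : Model} (i : A* ≤ A) (p : A ≤ B) (b : El B) →
    NotIn K p b → nf i p b → Sbs (≤-trans i p) b
  basic-over-base i p b b∉A nf-b =
    nf-bs (≤-trans i p) b (notIn-below i p b b∉A) nf-over-A*
    where
    nf-over-A* : nf ≤-refl (≤-trans i p) b
    nf-over-A* = nf-mono ≤-refl ≤-refl i p b b∉A
      (subst (λ j → nf j p b) (≤-prop i (≤-trans ≤-refl (≤-trans ≤-refl i))) nf-b)

  -- Since the data are unchanged, equivalence of
  -- amalgamations and the types over C are the same for both readings.
  restrictAmalg : {A* A B C : Model} (i : A* ≤ A) {p : A ≤ B} {r : A ≤ C} →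
    Amalg s p r → Amalg s (≤-trans i p) (≤-trans i r)
  restrictAmalg {A* = A*} i {p} {r} a = record
    { D = D ; fB = fB ; idC = idC ; over = over-A* }
    where
    open Amalg a
    open ≡-Reasoning
    over-A* : (x : El A*) →
      ap fB (ap (ι (≤-trans i p)) x) ≡ ap (ι idC) (ap (ι (≤-trans i r)) x)
    over-A* x = begin
      ap fB (ap (ι (≤-trans i p)) x)   ≡⟨ cong (ap fB) (ι-trans i p x) ⟩
      ap fB (ap (ι p) (ap (ι i) x))    ≡⟨ over (ap (ι i) x) ⟩
      ap (ι idC) (ap (ι r) (ap (ι i) x)) ≡⟨ cong (ap (ι idC)) (sym (ι-trans i r x)) ⟩
      ap (ι idC) (ap (ι (≤-trans i r)) x) ∎

  nf-along-amalg : {A* A B C : Model} (i : A* ≤ A) (p : A ≤ B) (r : A ≤ C)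
    (a : Amalg s p r) (b : El B) → NotIn K p b → nf i p b →
    nf i (≤-trans r (Amalg.idC a)) (ap (Amalg.fB a) b)
  nf-along-amalg {A = A} i p r a b b∉A nf-b =
    proj₁ (nf-inv i p (≤-trans r idC) fB b fixes-A b∉A) nf-b
    where
    open Amalg a
    fixes-A : (x : El A) → ap fB (ap (ι p) x) ≡ ap (ι (≤-trans r idC)) x
    fixes-A x = trans (over x) (sym (ι-trans r idC x))

lemma10p22 : (s : PreFrame) → Transitivity s →
    let open PreFrame s in
    {A* A B C : Model} (i : A* ≤ A) (p : A ≤ B) (b : El B) (r : A ≤ C) →
    NotIn K p b → nf i p b →
    Witness s p b r → Witness s (≤-trans i p) b (≤-trans i r)
lemma10p22 s transitivity i p b r b∉A nf-b
  (_ , (c , c∉A) , a₁ , a₂ , a₁≉a₂ , same-tp , b₁∉C , nf-b₁) =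
  ( (notIn-below s i p b b∉A , basic-over-base s i p b b∉A nf-b)
  , (c , notIn-below s i r c c∉A)
  , restrictAmalg s i a₁ , restrictAmalg s i a₂
  , a₁≉a₂ , same-tp , b₁∉C
  , transitivity i r (Amalg.idC a₁) (PreFrame.ap s (Amalg.fB a₁) b) b₁∉C nf-b₁
      (nf-along-amalg s i p r a₁ b b∉A nf-b) )
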